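{- For any labeled polytree $G = ( V, E, L )$, and for any vertices $x, y \in V$, the nested sequent $\mathfrak{N}_{x}(G)$ is derivable from $\mathfrak{N}_{y}(G)$ via the display rules $(\textsf{rf})$ and $(\textsf{rp})$.
   Context: Tense formulae: $A ::= p \mid \overline{p} \mid A\wedge A \mid A\vee A \mid \Box A \mid \Diamond A \mid \blacksquare A \mid \Diamond^{ - }A$, with $\Diamond^{ - }$ the past diamond. Nested sequents: $X ::= \varepsilon \mid A \mid X,X \mid \circ\{X\} \mid \bullet\{X\}$. Display rules: $(\textsf{rf})$ from $X,\circ\{Y\}$ infer $\bullet\{X\},Y$; $(\textsf{rp})$ from $X,\bullet\{Y\}$ infer $\circ\{X\},Y$. A labeled polytree is a directed graph $(V,E)$ with labeling $L$ of vertices by multisets of formulae whose underlying undirected graph is a tree. For a vertex $x$, $\mathfrak{N}_x(G)$ is defined recursively: if $E=\emptyset$ it is $L(x)$; otherwise, for the forward edges $(x,y_i)\in E$ ($1\le i\le n$) with $H_i$ the subpolytree hanging off $x$ through $y_i$, and backward edges $(z_j,x)\in E$ ($1\le j\le k$) with $H'_j$ the subpolytree hanging off $x$ through $z_j$, $\mathfrak{N}_x(G) = L(x),\circ\{\mathfrak{N}_{y_{1}}(H_{1})\},\ldots, \circ\{\mathfrak{N}_{y_{n}}(H_{n})\}, \bullet\{\mathfrak{N}_{z_{1}}(H_{1}')\},\ldots, \bullet\{\mathfrak{N}_{z_{k}}(H_{k}')\}$. -}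

module Defs where

open import Data.Nat using (ℕ; zero; suc; _+_)
open import Data.Fin using (Fin)
open import Data.Fin.Properties using (_≟_)
open import Data.List using (List; []; _∷_; _++_; map; length)
open import Data.Maybe using (Maybe; just; nothing)
open import Data.Product using (_×_; _,_)
open import Data.List.Membership.Propositional using (_∈_)
open import Relation.Nullary using (yes; no)
open import Relation.Binary.PropositionalEquality using (_≡_)

-- Tense formulae in negation normal form (atoms indexed by ℕ)
data Formula : Set where
  pos  : ℕ → Formula
  neg  : ℕ → Formula
  _∧_  : Formula → Formula → Formula
  _∨_  : Formula → Formula → Formula
  □    : Formula → Formula      -- future box
  ◇    : Formula → Formula      -- future diamond
  ■    : Formula → Formula      -- past box
  ◆    : Formula → Formula      -- past diamond

-- Nested sequents: a sequent is a list of items (ε = [], comma = _++_).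
mutual
  data Item : Set where
    fm : Formula → Item
    ∘⟨_⟩ : List Item → Item
    •⟨_⟩ : List Item → Item

Sequent : Set
Sequent = List Item

-- Sequents are considered up to (deep) permutation: comma is associative
-- and commutative with unit ε, at every nesting level.
mutual
  data _≃ᵢ_ : Item → Item → Set where
    fm≃ : ∀ {A} → fm A ≃ᵢ fm A
    ∘≃  : ∀ {X Y} → X ≈ Y → ∘⟨ X ⟩ ≃ᵢ ∘⟨ Y ⟩
    •≃  : ∀ {X Y} → X ≈ Y → •⟨ X ⟩ ≃ᵢ •⟨ Y ⟩

  data _≈_ : Sequent → Sequent → Set where
    []≈   : [] ≈ []
    ∷≈    : ∀ {a b X Y} → a ≃ᵢ b → X ≈ Y → (a ∷ X) ≈ (b ∷ Y)
    swap≈ : ∀ {a b X} → (a ∷ b ∷ X) ≈ (b ∷ a ∷ X)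
    trans≈ : ∀ {X Y Z} → X ≈ Y → Y ≈ Z → X ≈ Z

-- Display rules (premise ⟶ conclusion)
data DisplayStep : Sequent → Sequent → Set where
  rf : ∀ X Y → DisplayStep (X ++ (∘⟨ Y ⟩ ∷ [])) (•⟨ X ⟩ ∷ Y)
  rp : ∀ X Y → DisplayStep (X ++ (•⟨ Y ⟩ ∷ [])) (∘⟨ X ⟩ ∷ Y)

data Derivable : Sequent → Sequent → Set where
  done : ∀ {S T} → S ≈ T → Derivable S T
  step : ∀ {S S₁ S₂ T} → S ≈ S₁ → DisplayStep S₁ S₂ → Derivable S₂ T →
         Derivable S T

record Polytree : Set where
  field
    n     : ℕ
    E     : List (Fin n × Fin n)
    L     : Fin n → List Formula

data Reach {n : ℕ} (E : List (Fin n × Fin n)) : Fin n → Fin n → Set where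
  here : ∀ {x} → Reach E x x
  fwd  : ∀ {x y z} → (x , y) ∈ E → Reach E y z → Reach E x z
  bwd  : ∀ {x y z} → (y , x) ∈ E → Reach E y z → Reach E x z

-- underlying undirected (multi)graph is a tree: connected with |V| - 1 edges
IsPolytree : Polytree → Set
IsPolytree G = (length E + 1 ≡ n) × (∀ x y → Reach E x y)
  where open Polytree G

module _ (G : Polytree) where
  open Polytree G

  private
    notParent : Maybe (Fin n) → Fin n → List (Fin n) → List (Fin n)
    notParent nothing y ys = y ∷ ys
    notParent (just p) y ys with p ≟ y
    ... | yes _ = ys
    ... | no _  = y ∷ ys

  succs : Fin n → Maybe (Fin n) → List (Fin n × Fin n) → List (Fin n)
  succs x p [] = []
  succs x p ((a , b) ∷ es) with a ≟ x
  ... | yes _ = notParent p b (succs x p es)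
  ... | no _  = succs x p es

  preds : Fin n → Maybe (Fin n) → List (Fin n × Fin n) → List (Fin n)
  preds x p [] = []
  preds x p ((a , b) ∷ es) with b ≟ x
  ... | yes _ = notParent p a (preds x p es)
  ... | no _  = preds x p es

  -- 𝔑 of the subpolytree rooted at x hanging off parent p (fuel bounds depth)
  𝔑aux : ℕ → Maybe (Fin n) → Fin n → Sequent
  𝔑aux zero p x = map fm (L x)
  𝔑aux (suc k) p x =
    map fm (L x)
    ++ map (λ y → ∘⟨ 𝔑aux k (just x) y ⟩) (succs x p E)
    ++ map (λ z → •⟨ 𝔑aux k (just x) z ⟩) (preds x p E)

  -- 𝔑_x(G); fuel n suffices since paths in a tree have < n edges
  𝔑 : Fin n → Sequent
  𝔑 x = 𝔑aux n nothing x

module Submission where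

-- Derivability is symmetric, since (rf) and (rp) undo each other, and the polytree is
-- connected, so it suffices to pass from 𝔑_x to 𝔑_y along a single edge x → y. Then
-- 𝔑_x = X, ∘{N}, where N is the part hanging off y, and one (rf) step gives •{X}, N, which
-- is 𝔑_y up to the order of its components. Here the tree shape is needed for the fuel:
-- |E| + 1 = |V| together with connectivity makes every edge a bridge, so a walk that
-- never turns back visits distinct vertices, and the fuel n exceeds every depth.

open import Defs
open import Data.Fin using (Fin; zero; suc; punchOut; punchIn)
open import Data.Fin.Properties
  using (_≟_; punchOut-cong; punchOut-punchIn; punchInᵢ≢i; injective⇒≤)
open import Data.List using (List; []; _∷_; _++_; [_]; map; length; lookup)
open import Data.List.Properties using (++-identityʳ; map-++; length-++; length-map)
open import Data.List.Membership.Propositional using (_∈_; _∉_)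
open import Data.List.Membership.Propositional.Properties
  using (∈-map⁺; ∈-map⁻; ∈-∃++; ∈-++⁻; ∈-++⁺ˡ; ∈-++⁺ʳ; ∈-lookup)
open import Data.List.Relation.Unary.All as All using (All; []; _∷_)
open import Data.List.Relation.Unary.AllPairs using ([]; _∷_)
open import Data.List.Relation.Unary.Any using (here; there)
open import Data.List.Relation.Unary.Unique.Propositional using (Unique)
open import Data.Maybe using (Maybe; just; nothing)
open import Data.Nat using (ℕ; zero; suc; _+_; _≤_; z≤n; s≤s)
open import Data.Nat.Properties using (≤-trans; ≤-reflexive; m≤n⇒m≤1+n; n≤1+n; +-suc; +-comm; 1+n≰n)
open import Data.Product using (_×_; _,_; proj₁; proj₂; ∃; ∃₂; swap)
import Data.Product as Prod
open import Data.Sum using (_⊎_; inj₁; inj₂)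
open import Function using (_∘_)
open import Relation.Binary.Bundles using (Setoid)
import Relation.Binary.Reasoning.Setoid as SetoidReasoning
open import Relation.Nullary using (¬_; yes; no; contradiction)
open import Relation.Binary.PropositionalEquality hiding ([_])

mutual
  ≃ᵢ-refl : ∀ {a} → a ≃ᵢ a
  ≃ᵢ-refl {fm A} = fm≃
  ≃ᵢ-refl {∘⟨ X ⟩} = ∘≃ ≈-refl
  ≃ᵢ-refl {•⟨ X ⟩} = •≃ ≈-refl

  ≈-refl : ∀ {X} → X ≈ X
  ≈-refl {[]} = []≈
  ≈-refl {a ∷ X} = ∷≈ ≃ᵢ-refl ≈-refl

mutual
  ≃ᵢ-sym : ∀ {a b} → a ≃ᵢ b → b ≃ᵢ a
  ≃ᵢ-sym fm≃ = fm≃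
  ≃ᵢ-sym (∘≃ X≈Y) = ∘≃ (≈-sym X≈Y)
  ≃ᵢ-sym (•≃ X≈Y) = •≃ (≈-sym X≈Y)

  ≈-sym : ∀ {X Y} → X ≈ Y → Y ≈ X
  ≈-sym []≈ = []≈
  ≈-sym (∷≈ a≃b X≈Y) = ∷≈ (≃ᵢ-sym a≃b) (≈-sym X≈Y)
  ≈-sym swap≈ = swap≈
  ≈-sym (trans≈ X≈Y Y≈Z) = trans≈ (≈-sym Y≈Z) (≈-sym X≈Y)

≈-setoid : Setoid _ _
≈-setoid = record
  { Carrier = Sequent
  ; _≈_ = _≈_
  ; isEquivalence = record { refl = ≈-refl ; sym = ≈-sym ; trans = trans≈ }
  }

++-congˡ : ∀ X {Y Y′} → Y ≈ Y′ → (X ++ Y) ≈ (X ++ Y′)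
++-congˡ [] Y≈Y′ = Y≈Y′
++-congˡ (a ∷ X) Y≈Y′ = ∷≈ ≃ᵢ-refl (++-congˡ X Y≈Y′)

++-congʳ : ∀ {X X′} Y → X ≈ X′ → (X ++ Y) ≈ (X′ ++ Y)
++-congʳ Y []≈ = ≈-refl
++-congʳ Y (∷≈ a≃b X≈X′) = ∷≈ a≃b (++-congʳ Y X≈X′)
++-congʳ Y swap≈ = swap≈
++-congʳ Y (trans≈ X≈X′ X′≈X″) = trans≈ (++-congʳ Y X≈X′) (++-congʳ Y X′≈X″)

∷-++-≈ : ∀ a X Y → (a ∷ X ++ Y) ≈ (X ++ a ∷ Y)
∷-++-≈ a [] Y = ≈-refl
∷-++-≈ a (b ∷ X) Y = trans≈ swap≈ (∷≈ ≃ᵢ-refl (∷-++-≈ a X Y))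

∷≈∷ʳ : ∀ a X → (a ∷ X) ≈ (X ++ [ a ])
∷≈∷ʳ a X = subst (λ Z → (a ∷ Z) ≈ (X ++ [ a ])) (++-identityʳ X) (∷-++-≈ a X [])

map-++-∷-≈ : ∀ {A : Set} (h : A → Item) S₁ y S₂ → map h (S₁ ++ y ∷ S₂) ≈ (h y ∷ map h (S₁ ++ S₂))
map-++-∷-≈ h S₁ y S₂ = begin
  map h (S₁ ++ y ∷ S₂)           ≡⟨ map-++ h S₁ (y ∷ S₂) ⟩
  map h S₁ ++ h y ∷ map h S₂     ≈⟨ ≈-sym (∷-++-≈ (h y) (map h S₁) (map h S₂)) ⟩
  h y ∷ map h S₁ ++ map h S₂     ≡⟨ cong (h y ∷_) (map-++ h S₁ S₂) ⟨
  h y ∷ map h (S₁ ++ S₂)         ∎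
  where open SetoidReasoning ≈-setoid

map-cong-≈ : ∀ {A : Set} (K : Sequent → Item) → (∀ {X Y} → X ≈ Y → K X ≃ᵢ K Y) →
  {f g : A → Sequent} (cs : List A) → (∀ {c} → c ∈ cs → f c ≈ g c) →
  map (K ∘ f) cs ≈ map (K ∘ g) cs
map-cong-≈ K K-cong [] f≈g = []≈
map-cong-≈ K K-cong (c ∷ cs) f≈g =
  ∷≈ (K-cong (f≈g (here refl))) (map-cong-≈ K K-cong cs (f≈g ∘ there))

Derivable-respˡ : ∀ {S T U} → S ≈ T → Derivable T U → Derivable S U
Derivable-respˡ S≈T (done T≈U) = done (trans≈ S≈T T≈U)
Derivable-respˡ S≈T (step T≈T₁ r d) = step (trans≈ S≈T T≈T₁) r d

Derivable-respʳ : ∀ {S T U} → Derivable S T → T ≈ U → Derivable S U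
Derivable-respʳ (done S≈T) T≈U = done (trans≈ S≈T T≈U)
Derivable-respʳ (step S≈S₁ r d) T≈U = step S≈S₁ r (Derivable-respʳ d T≈U)

Derivable-trans : ∀ {S T U} → Derivable S T → Derivable T U → Derivable S U
Derivable-trans (done S≈T) d = Derivable-respˡ S≈T d
Derivable-trans (step S≈S₁ r d) d′ = step S≈S₁ r (Derivable-trans d d′)

-- The conclusion of (rf), reordered, is a premise of (rp), and vice versa.
DisplayStep-inverse : ∀ {S T} → DisplayStep S T → Derivable T S
DisplayStep-inverse (rf X Y) = step (∷≈∷ʳ _ Y) (rp Y X) (done (∷≈∷ʳ _ X))
DisplayStep-inverse (rp X Y) = step (∷≈∷ʳ _ Y) (rf Y X) (done (∷≈∷ʳ _ X))

Derivable-sym : ∀ {S T} → Derivable S T → Derivable T S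
Derivable-sym (done S≈T) = done (≈-sym S≈T)
Derivable-sym (step S≈S₁ r d) =
  Derivable-trans (Derivable-sym d) (Derivable-respʳ (DisplayStep-inverse r) (≈-sym S≈S₁))

module _ {n : ℕ} {E : List (Fin n × Fin n)} where

  Reach-trans : ∀ {x y z} → Reach E x y → Reach E y z → Reach E x z
  Reach-trans here r = r
  Reach-trans (fwd e r) r′ = fwd e (Reach-trans r r′)
  Reach-trans (bwd e r) r′ = bwd e (Reach-trans r r′)

  Reach-sym : ∀ {x y} → Reach E x y → Reach E y x
  Reach-sym here = here
  Reach-sym (fwd e r) = Reach-trans (Reach-sym r) (bwd e here)
  Reach-sym (bwd e r) = Reach-trans (Reach-sym r) (fwd e here)

Reach-map : ∀ {n m} {E : List (Fin n × Fin n)} {E′ : List (Fin m × Fin m)} (h : Fin n → Fin m) →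
  (∀ {u v} → (u , v) ∈ E → Reach E′ (h u) (h v)) → ∀ {x y} → Reach E x y → Reach E′ (h x) (h y)
Reach-map h h-edge here = here
Reach-map h h-edge (fwd e r) = Reach-trans (h-edge e) (Reach-map h h-edge r)
Reach-map h h-edge (bwd e r) = Reach-trans (Reach-sym (h-edge e)) (Reach-map h h-edge r)

Connected : ∀ {n} → List (Fin n × Fin n) → Set
Connected {n} E = ∀ (x y : Fin n) → Reach E x y

Reach-[] : ∀ {n} {x y : Fin n} → Reach [] x y → x ≡ y
Reach-[] here = refl

-- Merges a into b and then deletes a.
contract : ∀ {m} {a b : Fin (suc m)} → a ≢ b → Fin (suc m) → Fin m
contract {a = a} a≢b v with v ≟ a
... | yes _ = punchOut a≢b
... | no v≢a = punchOut (≢-sym v≢a)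

contract-merges : ∀ {m} {a b : Fin (suc m)} (a≢b : a ≢ b) → contract a≢b a ≡ contract a≢b b
contract-merges {a = a} {b} a≢b with a ≟ a | b ≟ a
... | no a≢a | _ = contradiction refl a≢a
... | yes _ | yes b≡a = contradiction (sym b≡a) a≢b
... | yes _ | no _ = punchOut-cong a refl

contract-punchIn : ∀ {m} {a b : Fin (suc m)} (a≢b : a ≢ b) u → contract a≢b (punchIn a u) ≡ u
contract-punchIn {a = a} a≢b u with punchIn a u ≟ a
... | yes eq = contradiction eq (punchInᵢ≢i a u)
... | no _ = punchOut-punchIn a

contract-connected : ∀ {m} {a b : Fin (suc m)} (a≢b : a ≢ b) {E} → Connected ((a , b) ∷ E) →
  Connected (map (Prod.map (contract a≢b) (contract a≢b)) E)
contract-connected {a = a} a≢b {E} conn x y =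
  subst₂ (Reach E′) (contract-punchIn a≢b x) (contract-punchIn a≢b y)
    (Reach-map f f-edge (conn (punchIn a x) (punchIn a y)))
  where
  f = contract a≢b
  E′ = map (Prod.map f f) E
  f-edge : ∀ {u v} → (u , v) ∈ (a , _) ∷ E → Reach E′ (f u) (f v)
  f-edge (here refl) = subst (Reach E′ (f a)) (contract-merges a≢b) here
  f-edge (there e) = fwd (∈-map⁺ (Prod.map f f) e) here

-- A loop is dropped; any other edge is contracted, which removes one vertex.
connected⇒≤1+length : ∀ {n} (E : List (Fin n × Fin n)) → Connected E → n ≤ suc (length E)
connected⇒≤1+length {zero} [] _ = z≤n
connected⇒≤1+length {suc zero} [] _ = s≤s z≤n
connected⇒≤1+length {suc (suc n)} [] conn = contradiction (Reach-[] (conn zero (suc zero))) λ ()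
connected⇒≤1+length ((a , b) ∷ E) conn with a ≟ b
... | yes refl =
  m≤n⇒m≤1+n (connected⇒≤1+length E (λ x y → Reach-map (λ v → v) drop-loop (conn x y)))
  where
  drop-loop : ∀ {u v} → (u , v) ∈ (a , a) ∷ E → Reach E u v
  drop-loop (here refl) = here
  drop-loop (there e) = fwd e here
connected⇒≤1+length {suc m} ((a , b) ∷ E) conn | no a≢b =
  s≤s (subst (m ≤_) (cong suc (length-map _ E))
    (connected⇒≤1+length _ (contract-connected a≢b conn)))

Unique⇒length≤ : ∀ {m} {vs : List (Fin m)} → Unique vs → length vs ≤ m
Unique⇒length≤ u = injective⇒≤ (lookup-injective u)
  where
  lookup-injective : ∀ {vs : List (Fin _)} → Unique vs →
    ∀ {i j} → lookup vs i ≡ lookup vs j → i ≡ j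
  lookup-injective (_ ∷ _) {zero} {zero} _ = refl
  lookup-injective (v∉ ∷ _) {zero} {suc j} eq = contradiction eq (All.lookup v∉ (∈-lookup j))
  lookup-injective (v∉ ∷ _) {suc i} {zero} eq = contradiction (sym eq) (All.lookup v∉ (∈-lookup i))
  lookup-injective (_ ∷ u) {suc i} {suc j} eq = cong suc (lookup-injective u eq)

∈-map-swap⁻ : ∀ {A B : Set} {a : A} {b : B} {L} → (a , b) ∈ map swap L → (b , a) ∈ L
∈-map-swap⁻ m with (_ , _) , m′ , refl ← ∈-map⁻ swap m = m′

∈-++-∷⁻ : ∀ {A : Set} (xs : List A) {x y ys} → x ∈ xs ++ y ∷ ys → x ≡ y ⊎ x ∈ xs ++ ys
∈-++-∷⁻ xs m with ∈-++⁻ xs m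
... | inj₁ m₁ = inj₂ (∈-++⁺ˡ m₁)
... | inj₂ (here x≡y) = inj₁ x≡y
... | inj₂ (there m₂) = inj₂ (∈-++⁺ʳ xs m₂)

pair-≢ : ∀ {A : Set} {z s t a b : A} → z ≡ s ⊎ z ≡ t → a ≢ z → b ≢ z → (a , b) ≢ (s , t)
pair-≢ (inj₁ refl) a≢z _ refl = a≢z refl
pair-≢ (inj₂ refl) _ b≢z refl = b≢z refl

two-elements : ∀ {m} {a b : Fin m} → a ≢ b → ∃ λ k → m ≡ suc (suc k)
two-elements {suc zero} {zero} {zero} a≢b = contradiction refl a≢b
two-elements {suc (suc k)} _ = k , refl

module Neighbours (G : Polytree) where
  open Polytree G

  succs-++ : ∀ x p L₁ L₂ → succs G x p (L₁ ++ L₂) ≡ succs G x p L₁ ++ succs G x p L₂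
  succs-++ x p [] L₂ = refl
  succs-++ x nothing ((a , b) ∷ L₁) L₂ with a ≟ x
  ... | no _ = succs-++ x nothing L₁ L₂
  ... | yes _ = cong (b ∷_) (succs-++ x nothing L₁ L₂)
  succs-++ x (just q) ((a , b) ∷ L₁) L₂ with a ≟ x
  ... | no _ = succs-++ x (just q) L₁ L₂
  ... | yes _ with q ≟ b
  ...   | yes _ = succs-++ x (just q) L₁ L₂
  ...   | no _ = cong (b ∷_) (succs-++ x (just q) L₁ L₂)

  succs-∉ : ∀ {x y} L → (x , y) ∉ L → succs G x nothing L ≡ succs G x (just y) L
  succs-∉ [] _ = refl
  succs-∉ {x} {y} ((a , b) ∷ L) xy∉ with a ≟ x
  ... | no _ = succs-∉ L (xy∉ ∘ there)
  ... | yes refl with y ≟ b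
  ...   | yes refl = contradiction (here refl) xy∉
  ...   | no _ = cong (b ∷_) (succs-∉ L (xy∉ ∘ there))

  succs-head : ∀ x y L → succs G x nothing ((x , y) ∷ L) ≡ y ∷ succs G x nothing L
  succs-head x y L with x ≟ x
  ... | yes _ = refl
  ... | no x≢x = contradiction refl x≢x

  succs-head-parent : ∀ x y L → succs G x (just y) ((x , y) ∷ L) ≡ succs G x (just y) L
  succs-head-parent x y L with x ≟ x
  ... | no x≢x = contradiction refl x≢x
  ... | yes _ with y ≟ y
  ...   | yes _ = refl
  ...   | no y≢y = contradiction refl y≢y

  succs-split : ∀ {x y} L₁ L₂ → (x , y) ∉ L₁ ++ L₂ → ∃₂ λ S₁ S₂ →
    succs G x nothing (L₁ ++ (x , y) ∷ L₂) ≡ S₁ ++ y ∷ S₂ ×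
    succs G x (just y) (L₁ ++ (x , y) ∷ L₂) ≡ S₁ ++ S₂
  succs-split {x} {y} L₁ L₂ xy∉ =
    succs G x nothing L₁ , succs G x nothing L₂ ,
    trans (succs-++ x nothing L₁ _) (cong (succs G x nothing L₁ ++_) (succs-head x y L₂)) ,
    trans (succs-++ x (just y) L₁ _)
      (cong₂ _++_ (sym (succs-∉ L₁ (xy∉ ∘ ∈-++⁺ˡ)))
                  (trans (succs-head-parent x y L₂) (sym (succs-∉ L₂ (xy∉ ∘ ∈-++⁺ʳ L₁)))))

  ∈-succs⁻ : ∀ {x q c} L → c ∈ succs G x (just q) L → (x , c) ∈ L × c ≢ q
  ∈-succs⁻ {x} {q} ((a , b) ∷ L) m with a ≟ x
  ... | no _ = Prod.map₁ there (∈-succs⁻ L m)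
  ... | yes refl with q ≟ b
  ...   | yes _ = Prod.map₁ there (∈-succs⁻ L m)
  ...   | no q≢b with m
  ...     | here refl = here refl , ≢-sym q≢b
  ...     | there m′ = Prod.map₁ there (∈-succs⁻ L m′)

  preds≡succs∘swap : ∀ x p L → preds G x p L ≡ succs G x p (map swap L)
  preds≡succs∘swap x p [] = refl
  preds≡succs∘swap x p ((a , b) ∷ L) with b ≟ x
  ... | no _ = preds≡succs∘swap x p L
  ... | yes _ rewrite preds≡succs∘swap x p L = refl

  ∈-preds⁻ : ∀ {x q c} L → c ∈ preds G x (just q) L → (c , x) ∈ L × c ≢ q
  ∈-preds⁻ {x} {q} L m =
    Prod.map₁ ∈-map-swap⁻ (∈-succs⁻ (map swap L) (subst (_ ∈_) (preds≡succs∘swap x (just q) L) m))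

  preds-∉ : ∀ {x y} L → (y , x) ∉ L → preds G x nothing L ≡ preds G x (just y) L
  preds-∉ {x} {y} L yx∉ = begin
    preds G x nothing L            ≡⟨ preds≡succs∘swap x nothing L ⟩
    succs G x nothing (map swap L) ≡⟨ succs-∉ (map swap L) (yx∉ ∘ ∈-map-swap⁻) ⟩
    succs G x (just y) (map swap L) ≡⟨ preds≡succs∘swap x (just y) L ⟨
    preds G x (just y) L           ∎
    where open ≡-Reasoning

  preds-split : ∀ {x y} L₁ L₂ → (x , y) ∉ L₁ ++ L₂ → ∃₂ λ P₁ P₂ →
    preds G y nothing (L₁ ++ (x , y) ∷ L₂) ≡ P₁ ++ x ∷ P₂ ×
    preds G y (just x) (L₁ ++ (x , y) ∷ L₂) ≡ P₁ ++ P₂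
  preds-split {x} {y} L₁ L₂ xy∉ =
    let P₁ , P₂ , eq₀ , eq₁ = succs-split (map swap L₁) (map swap L₂) (xy∉ ∘ swapped-∈) in
    P₁ , P₂ , swapped nothing eq₀ , swapped (just x) eq₁
    where
    swapped-∈ : (y , x) ∈ map swap L₁ ++ map swap L₂ → (x , y) ∈ L₁ ++ L₂
    swapped-∈ m = ∈-map-swap⁻ (subst ((y , x) ∈_) (sym (map-++ swap L₁ L₂)) m)
    swapped : ∀ p {S} → succs G y p (map swap L₁ ++ (y , x) ∷ map swap L₂) ≡ S →
      preds G y p (L₁ ++ (x , y) ∷ L₂) ≡ S
    swapped p eq = trans (preds≡succs∘swap y p (L₁ ++ (x , y) ∷ L₂))
                           (trans (cong (succs G y p) (map-++ swap L₁ ((x , y) ∷ L₂))) eq)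

module Nodes (G : Polytree) where
  open Polytree G

  -- 𝔑aux G (suc k) p z is definitionally node z p (𝔑aux G k (just z)).
  node : Fin n → Maybe (Fin n) → (Fin n → Sequent) → Sequent
  node z p f =
    map fm (L z) ++ map (λ c → ∘⟨ f c ⟩) (succs G z p E) ++ map (λ c → •⟨ f c ⟩) (preds G z p E)

  node-cong : ∀ z p {f g : Fin n → Sequent} →
    (∀ {c} → c ∈ succs G z p E → f c ≈ g c) → (∀ {c} → c ∈ preds G z p E → f c ≈ g c) →
    node z p f ≈ node z p g
  node-cong z p f≈gˢ f≈gᵖ =
    ++-congˡ (map fm (L z))
      (trans≈ (++-congʳ _ (map-cong-≈ ∘⟨_⟩ ∘≃ (succs G z p E) f≈gˢ))
              (++-congˡ _ (map-cong-≈ •⟨_⟩ •≃ (preds G z p E) f≈gᵖ)))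

  data DownPath (p : Maybe (Fin n)) (z : Fin n) : ℕ → Set where
    stop  : DownPath p z zero
    down∘ : ∀ {k c} → c ∈ succs G z p E → DownPath (just z) c k → DownPath p z (suc k)
    down• : ∀ {k c} → c ∈ preds G z p E → DownPath (just z) c k → DownPath p z (suc k)

  𝔑aux-saturated : ∀ k j p z → ¬ DownPath p z k → k ≤ j → 𝔑aux G j p z ≈ 𝔑aux G k p z
  𝔑aux-saturated zero j p z ¬path _ = contradiction stop ¬path
  𝔑aux-saturated (suc k) (suc j) p z ¬path (s≤s k≤j) =
    node-cong z p (λ c∈ → 𝔑aux-saturated k j (just z) _ (¬path ∘ down∘ c∈) k≤j)
                  (λ c∈ → 𝔑aux-saturated k j (just z) _ (¬path ∘ down• c∈) k≤j)

module PolytreeFacts (G : Polytree) (T : IsPolytree G) where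
  open Polytree G
  open Neighbours G
  open Nodes G

  Adj : Fin n → Fin n → Set
  Adj a b = (a , b) ∈ E ⊎ (b , a) ∈ E

  edge-bridge : ∀ E₁ E₂ {s t} → E ≡ E₁ ++ (s , t) ∷ E₂ → ¬ Reach (E₁ ++ E₂) s t
  edge-bridge E₁ E₂ {s} {t} E≡ s⇝t =
    1+n≰n (subst (_≤ suc (length (E₁ ++ E₂))) n≡ (connected⇒≤1+length _ connected))
    where
    via-bridge : ∀ {u v} → (u , v) ∈ E → Reach (E₁ ++ E₂) u v
    via-bridge m with ∈-++-∷⁻ E₁ (subst ((_ , _) ∈_) E≡ m)
    ... | inj₁ refl = s⇝t
    ... | inj₂ m′ = fwd m′ here
    connected : Connected (E₁ ++ E₂)
    connected x y = Reach-map (λ v → v) via-bridge (proj₂ T x y)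
    n≡ : n ≡ suc (suc (length (E₁ ++ E₂)))
    n≡ = begin
      n                                   ≡⟨ proj₁ T ⟨
      length E + 1                        ≡⟨ +-comm (length E) 1 ⟩
      suc (length E)                      ≡⟨ cong (λ L → suc (length L)) E≡ ⟩
      suc (length (E₁ ++ (s , t) ∷ E₂))    ≡⟨ cong suc (length-++ E₁) ⟩
      suc (length E₁ + suc (length E₂))   ≡⟨ cong suc (+-suc (length E₁) (length E₂)) ⟩
      suc (suc (length E₁ + length E₂))   ≡⟨ cong (λ l → suc (suc l)) (length-++ E₁) ⟨
      suc (suc (length (E₁ ++ E₂)))       ∎
      where open ≡-Reasoning

  edge-split : ∀ {e} → e ∈ E → ∃₂ λ E₁ E₂ → E ≡ E₁ ++ e ∷ E₂ × e ∉ E₁ ++ E₂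
  edge-split m with E₁ , E₂ , E≡ ← ∈-∃++ m =
    E₁ , E₂ , E≡ , λ m′ → edge-bridge E₁ E₂ E≡ (fwd m′ here)

  no-loop : ∀ {x} → (x , x) ∉ E
  no-loop m with E₁ , E₂ , E≡ , _ ← edge-split m = edge-bridge E₁ E₂ E≡ here

  Adj-≢ : ∀ {x y} → Adj x y → x ≢ y
  Adj-≢ (inj₁ m) refl = no-loop m
  Adj-≢ (inj₂ m) refl = no-loop m

  no-antiparallel : ∀ {x y} → (x , y) ∈ E → (y , x) ∉ E
  no-antiparallel {x} {y} xy yx with E₁ , E₂ , E≡ , _ ← edge-split xy
    with ∈-++-∷⁻ E₁ (subst ((y , x) ∈_) E≡ yx)
  ... | inj₁ refl = no-loop xy
  ... | inj₂ yx′ = edge-bridge E₁ E₂ E≡ (bwd yx′ here)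

  lift-edge : ∀ {E₁ E₂ e₀ e} → E ≡ E₁ ++ e₀ ∷ E₂ → e ∈ E → e ≢ e₀ → e ∈ E₁ ++ E₂
  lift-edge {E₁} {e = e} E≡ m e≢e₀ with ∈-++-∷⁻ E₁ (subst (e ∈_) E≡ m)
  ... | inj₁ e≡e₀ = contradiction e≡e₀ e≢e₀
  ... | inj₂ m′ = m′

  Adj-reach-without : ∀ {E₁ E₂ e₀ u v} → E ≡ E₁ ++ e₀ ∷ E₂ →
    Adj u v → (u , v) ≢ e₀ → (v , u) ≢ e₀ → Reach (E₁ ++ E₂) u v
  Adj-reach-without E≡ (inj₁ m) uv≢ _ = fwd (lift-edge E≡ m uv≢) here
  Adj-reach-without E≡ (inj₂ m) _ vu≢ = bwd (lift-edge E≡ m vu≢) here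

  data ReachAvoiding (q : Fin n) : Fin n → Fin n → Set where
    stay : ∀ {x} → x ≢ q → ReachAvoiding q x x
    hop  : ∀ {x y z} → Adj x y → x ≢ q → ReachAvoiding q y z → ReachAvoiding q x z

  avoiding-head : ∀ {q x v} → ReachAvoiding q x v → x ≢ q
  avoiding-head (stay x≢q) = x≢q
  avoiding-head (hop _ x≢q _) = x≢q

  avoiding-last : ∀ {q x v} → ReachAvoiding q x v → v ≢ q
  avoiding-last (stay v≢q) = v≢q
  avoiding-last (hop _ _ r) = avoiding-last r

  avoiding-or-hits : ∀ {z q w v} → ReachAvoiding z w v → ReachAvoiding q w v ⊎ ReachAvoiding z w q
  avoiding-or-hits {q = q} {w} r with w ≟ q
  avoiding-or-hits (stay w≢z) | yes refl = inj₂ (stay w≢z)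
  avoiding-or-hits (hop _ w≢z _) | yes refl = inj₂ (stay w≢z)
  avoiding-or-hits (stay _) | no w≢q = inj₁ (stay w≢q)
  avoiding-or-hits {q = q} (hop wy w≢z r) | no w≢q with avoiding-or-hits {q = q} r
  ... | inj₁ r′ = inj₁ (hop wy w≢q r′)
  ... | inj₂ r′ = inj₂ (hop wy w≢z r′)

  avoiding⇒Reach-without : ∀ {E₁ E₂ s t z w v} → E ≡ E₁ ++ (s , t) ∷ E₂ → z ≡ s ⊎ z ≡ t →
    ReachAvoiding z w v → Reach (E₁ ++ E₂) w v
  avoiding⇒Reach-without E≡ z∈st (stay _) = here
  avoiding⇒Reach-without E≡ z∈st (hop xy x≢z r) =
    Reach-trans (Adj-reach-without E≡ xy (pair-≢ z∈st x≢z (avoiding-head r))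
                                          (pair-≢ z∈st (avoiding-head r) x≢z))
                (avoiding⇒Reach-without E≡ z∈st r)

  -- Otherwise the edge z–c would close a cycle through q.
  neighbours-separated : ∀ {q z c} → Adj q z → Adj z c → c ≢ q → ¬ ReachAvoiding z c q
  neighbours-separated qz (inj₁ zc) c≢q c⇝q with E₁ , E₂ , E≡ , _ ← edge-split zc =
    edge-bridge E₁ E₂ E≡ (Reach-sym (Reach-trans (avoiding⇒Reach-without E≡ (inj₁ refl) c⇝q)
      (Adj-reach-without E≡ qz (Adj-≢ qz ∘ cong proj₁) (c≢q ∘ sym ∘ cong proj₂))))
  neighbours-separated qz (inj₂ cz) c≢q c⇝q with E₁ , E₂ , E≡ , _ ← edge-split cz =
    edge-bridge E₁ E₂ E≡ (Reach-trans (avoiding⇒Reach-without E≡ (inj₂ refl) c⇝q)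
      (Adj-reach-without E≡ qz (c≢q ∘ sym ∘ cong proj₁) (Adj-≢ (inj₂ cz) ∘ cong proj₁)))

  branch-step : ∀ {q z c v} → Adj q z → Adj z c → c ≢ q → ReachAvoiding z c v → ReachAvoiding q z v
  branch-step {q} qz zc c≢q r with avoiding-or-hits {q = q} r
  ... | inj₁ r′ = hop zc (≢-sym (Adj-≢ qz)) r′
  ... | inj₂ r′ = contradiction r′ (neighbours-separated qz zc c≢q)

  -- Invariant along a down-path: the vertices already visited lie behind the current one,
  -- so they are pairwise distinct.
  Unreachable : Fin n → Fin n → List (Fin n) → Set
  Unreachable q z vs = ∀ {v} → v ∈ vs → ¬ ReachAvoiding q z v

  Unreachable⇒∉ : ∀ {q z vs} → Adj q z → Unreachable q z vs → All (z ≢_) vs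
  Unreachable⇒∉ qz unreachable =
    All.tabulate λ v∈ z≡v →
      unreachable v∈ (subst (ReachAvoiding _ _) z≡v (stay (≢-sym (Adj-≢ qz))))

  Unreachable-step : ∀ {q z c vs} → Adj q z → Adj z c → c ≢ q →
    Unreachable q z vs → Unreachable z c (z ∷ vs)
  Unreachable-step _ _ _ _ (here refl) r = avoiding-last r refl
  Unreachable-step qz zc c≢q unreachable (there v∈) r = unreachable v∈ (branch-step qz zc c≢q r)

  DownPath-bound : ∀ m {q z} vs → Adj q z → Unique vs → Unreachable q z vs →
    DownPath (just q) z m → suc (m + length vs) ≤ n
  DownPath-bound zero vs qz u unreachable stop = Unique⇒length≤ (Unreachable⇒∉ qz unreachable ∷ u)
  DownPath-bound (suc k) vs qz u unreachable (down∘ c∈ path) =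
    let zc , c≢q = ∈-succs⁻ E c∈ in
    subst (_≤ n) (cong suc (+-suc k (length vs)))
      (DownPath-bound k (_ ∷ vs) (inj₁ zc) (Unreachable⇒∉ qz unreachable ∷ u)
        (Unreachable-step qz (inj₁ zc) c≢q unreachable) path)
  DownPath-bound (suc k) vs qz u unreachable (down• c∈ path) =
    let cz , c≢q = ∈-preds⁻ E c∈ in
    subst (_≤ n) (cong suc (+-suc k (length vs)))
      (DownPath-bound k (_ ∷ vs) (inj₂ cz) (Unreachable⇒∉ qz unreachable ∷ u)
        (Unreachable-step qz (inj₂ cz) c≢q unreachable) path)

  no-long-DownPath : ∀ {p z k} → Adj p z → n ≤ suc k → ¬ DownPath (just p) z k
  no-long-DownPath {k = k} pz n≤ path =
    1+n≰n (≤-trans (subst (_≤ n) (cong suc (+-comm k 1)) bound) n≤)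
    where
    bound : suc (k + 1) ≤ n
    bound = DownPath-bound k [ _ ] pz ([] ∷ []) (λ { (here refl) r → avoiding-last r refl }) path

  𝔑aux-stable : ∀ {p z k j} → Adj p z → n ≤ suc k → k ≤ j →
    𝔑aux G j (just p) z ≈ 𝔑aux G k (just p) z
  𝔑aux-stable {p} {z} {k} {j} pz n≤ k≤j =
    𝔑aux-saturated k j (just p) z (no-long-DownPath pz n≤) k≤j

  succs-edge : ∀ {x y} → (x , y) ∈ E → ∃₂ λ S₁ S₂ →
    succs G x nothing E ≡ S₁ ++ y ∷ S₂ × succs G x (just y) E ≡ S₁ ++ S₂
  succs-edge {x} {y} xy with E₁ , E₂ , E≡ , xy∉ ← edge-split xy =
    let S₁ , S₂ , eq₀ , eq₁ = succs-split E₁ E₂ xy∉ in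
    S₁ , S₂ , trans (cong (succs G x nothing) E≡) eq₀ , trans (cong (succs G x (just y)) E≡) eq₁

  preds-edge : ∀ {x y} → (x , y) ∈ E → ∃₂ λ P₁ P₂ →
    preds G y nothing E ≡ P₁ ++ x ∷ P₂ × preds G y (just x) E ≡ P₁ ++ P₂
  preds-edge {x} {y} xy with E₁ , E₂ , E≡ , xy∉ ← edge-split xy =
    let P₁ , P₂ , eq₀ , eq₁ = preds-split E₁ E₂ xy∉ in
    P₁ , P₂ , trans (cong (preds G y nothing) E≡) eq₀ , trans (cong (preds G y (just x)) E≡) eq₁

  node-detach-succ : ∀ {x y} → (x , y) ∈ E → ∀ f →
    node x nothing f ≈ (node x (just y) f ++ [ ∘⟨ f y ⟩ ])
  node-detach-succ {x} {y} xy f =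
    let S₁ , S₂ , eq₀ , eq₁ = succs-edge xy
        Lx = map fm (L x)
        ∘f = λ c → ∘⟨ f c ⟩
        •f = λ c → •⟨ f c ⟩
        P = map •f (preds G x (just y) E)
    in begin
    node x nothing f
      ≡⟨ cong₂ (λ S′ P′ → Lx ++ map ∘f S′ ++ map •f P′)
               eq₀ (preds-∉ E (no-antiparallel xy)) ⟩
    Lx ++ map ∘f (S₁ ++ y ∷ S₂) ++ P
      ≈⟨ ++-congˡ Lx (++-congʳ P (map-++-∷-≈ ∘f S₁ y S₂)) ⟩
    Lx ++ ∘f y ∷ map ∘f (S₁ ++ S₂) ++ P
      ≈⟨ ∷-++-≈ (∘f y) Lx _ ⟨
    ∘f y ∷ Lx ++ map ∘f (S₁ ++ S₂) ++ P
      ≈⟨ ∷≈∷ʳ (∘f y) _ ⟩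
    (Lx ++ map ∘f (S₁ ++ S₂) ++ P) ++ [ ∘f y ]
      ≡⟨ cong (λ S → (Lx ++ map ∘f S ++ P) ++ [ ∘f y ]) eq₁ ⟨
    node x (just y) f ++ [ ∘f y ] ∎
    where open SetoidReasoning ≈-setoid

  node-detach-pred : ∀ {x y} → (x , y) ∈ E → ∀ f →
    node y nothing f ≈ (•⟨ f x ⟩ ∷ node y (just x) f)
  node-detach-pred {x} {y} xy f =
    let P₁ , P₂ , eq₀ , eq₁ = preds-edge xy
        Ly = map fm (L y)
        ∘f = λ c → ∘⟨ f c ⟩
        •f = λ c → •⟨ f c ⟩
        S = map ∘f (succs G y (just x) E)
    in begin
    node y nothing f
      ≡⟨ cong₂ (λ S′ P′ → Ly ++ map ∘f S′ ++ map •f P′)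
               (succs-∉ E (no-antiparallel xy)) eq₀ ⟩
    Ly ++ S ++ map •f (P₁ ++ x ∷ P₂)
      ≈⟨ ++-congˡ Ly (++-congˡ S (map-++-∷-≈ •f P₁ x P₂)) ⟩
    Ly ++ S ++ •f x ∷ map •f (P₁ ++ P₂)
      ≈⟨ ++-congˡ Ly (∷-++-≈ (•f x) S _) ⟨
    Ly ++ •f x ∷ S ++ map •f (P₁ ++ P₂)
      ≈⟨ ∷-++-≈ (•f x) Ly _ ⟨
    •f x ∷ Ly ++ S ++ map •f (P₁ ++ P₂)
      ≡⟨ cong (λ P → •f x ∷ Ly ++ S ++ map •f P) eq₁ ⟨
    •f x ∷ node y (just x) f ∎
    where open SetoidReasoning ≈-setoid

  -- Fuel 2 + k with n ≤ 2 + k makes both subtrees saturated, so (rf) swaps the root.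
  𝔑aux-edge : ∀ {x y k} → (x , y) ∈ E → n ≤ suc (suc k) →
    Derivable (𝔑aux G (suc (suc k)) nothing x) (𝔑aux G (suc (suc k)) nothing y)
  𝔑aux-edge {x} {y} {k} xy n≤ =
    step (node-detach-succ xy Fx) (rf (node x (just y) Fx) (Fx y)) (done (≈-sym (begin
      node y nothing Fy                 ≈⟨ node-detach-pred xy Fy ⟩
      •⟨ Fy x ⟩ ∷ node y (just x) Fy    ≈⟨ ∷≈ (•≃ x-stable) y-stable ⟩
      •⟨ node x (just y) Fx ⟩ ∷ Fx y    ∎)))
    where
    open SetoidReasoning ≈-setoid
    Fx = 𝔑aux G (suc k) (just x)
    Fy = 𝔑aux G (suc k) (just y)
    x-stable : Fy x ≈ node x (just y) Fx
    x-stable = ≈-sym (𝔑aux-stable (inj₂ xy) n≤ (n≤1+n (suc k)))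
    y-stable : node y (just x) Fy ≈ Fx y
    y-stable = 𝔑aux-stable (inj₁ xy) n≤ (n≤1+n (suc k))

  𝔑-edge : ∀ {x y} → (x , y) ∈ E → Derivable (𝔑 G x) (𝔑 G y)
  𝔑-edge {x} {y} xy with k , n≡ ← two-elements (Adj-≢ (inj₁ xy)) =
    subst (λ N → Derivable (𝔑aux G N nothing x) (𝔑aux G N nothing y)) (sym n≡)
      (𝔑aux-edge xy (≤-reflexive n≡))

  𝔑-reach : ∀ {x y} → Reach E x y → Derivable (𝔑 G x) (𝔑 G y)
  𝔑-reach here = done ≈-refl
  𝔑-reach (fwd xy r) = Derivable-trans (𝔑-edge xy) (𝔑-reach r)
  𝔑-reach (bwd yx r) = Derivable-trans (Derivable-sym (𝔑-edge yx)) (𝔑-reach r)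

lemma3p11 : (G : Polytree) → IsPolytree G →
    (x y : Fin (Polytree.n G)) → Derivable (𝔑 G y) (𝔑 G x)
lemma3p11 G T x y = PolytreeFacts.𝔑-reach G T (proj₂ T y x)
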